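{- Let $(S,\mathcal{U})$ be a composable map and let $U_1\subseteq U_2\subseteq U_3\subseteq\mathcal{U}$ be such that $S(U_1)=S(U_3)$. Then $S(U_2)=S(U_1)=S(U_3)$.
   Context: $(S,\mathcal{U})$: finite ground set $\mathcal{U}$ and map $S:2^{\mathcal{U}}\to\Sigma$; composable means there is a binary operation $\oplus$ on $\Sigma$ with $S(U\cup V)=S(U)\oplus S(V)$ for all $U,V\subseteq\mathcal{U}$. -}

module Defs where

open import Level using (Level)
open import Data.Nat using (ℕ)
open import Data.Fin.Subset using (Subset; _∪_)
open import Data.Product using (Σ)
open import Relation.Binary.PropositionalEquality using (_≡_)

Composable : ∀ {a} {Sig : Set a} {n : ℕ} → (Subset n → Sig) → Set a
Composable {Sig = Sig} {n = n} S =
  Σ (Sig → Sig → Sig) λ _⊕_ → ∀ (U V : Subset n) → S (U ∪ V) ≡ (S U ⊕ S V)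

{-# OPTIONS --safe #-}
module Submission where

open import Defs
open import Data.Nat using (ℕ)
open import Data.Fin.Subset using (Subset; _⊆_; _∪_)
open import Data.Fin.Subset.Properties using (⊆-antisym; x∈p∪q⁻; q⊆p∪q; ∪-comm)
open import Data.Product using (Σ; _×_; _,_)
open import Data.Sum using ([_,_])
open import Function using (id)
open import Relation.Binary.PropositionalEquality using (_≡_; cong; sym; trans; module ≡-Reasoning)

p⊆q⇒p∪q≡q : ∀ {n} {p q : Subset n} → p ⊆ q → p ∪ q ≡ q
p⊆q⇒p∪q≡q {p = p} {q} p⊆q =
  ⊆-antisym (λ x∈p∪q → [ p⊆q , id ] (x∈p∪q⁻ p q x∈p∪q)) (q⊆p∪q p q)

module _ {a} {Sig : Set a} {n : ℕ} {S : Subset n → Sig} (composable : Composable S) where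

  open Σ composable renaming (proj₁ to _⊕_; proj₂ to S-∪)

  absorbs-⊆ : ∀ {U V : Subset n} → U ⊆ V → S V ≡ S U ⊕ S V
  absorbs-⊆ {U} {V} U⊆V = begin
    S V         ≡⟨ cong S (sym (p⊆q⇒p∪q≡q U⊆V)) ⟩
    S (U ∪ V)   ≡⟨ S-∪ U V ⟩
    S U ⊕ S V   ∎
    where open ≡-Reasoning

  sandwiched-constant : ∀ {U₁ U₂ U₃ : Subset n} → U₁ ⊆ U₂ → U₂ ⊆ U₃ →
                        S U₁ ≡ S U₃ → S U₂ ≡ S U₃
  sandwiched-constant {U₁} {U₂} {U₃} U₁⊆U₂ U₂⊆U₃ SU₁≡SU₃ = begin
    S U₂          ≡⟨ absorbs-⊆ U₁⊆U₂ ⟩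
    S U₁ ⊕ S U₂   ≡⟨ cong (_⊕ S U₂) SU₁≡SU₃ ⟩
    S U₃ ⊕ S U₂   ≡⟨ sym (S-∪ U₃ U₂) ⟩
    S (U₃ ∪ U₂)   ≡⟨ cong S (∪-comm U₃ U₂) ⟩
    S (U₂ ∪ U₃)   ≡⟨ cong S (p⊆q⇒p∪q≡q U₂⊆U₃) ⟩
    S U₃          ∎
    where open ≡-Reasoning

mainTheorem11 : ∀ {a} {Sig : Set a} (n : ℕ) (S : Subset n → Sig) →
    Composable S →
    (U₁ U₂ U₃ : Subset n) → U₁ ⊆ U₂ → U₂ ⊆ U₃ →
    S U₁ ≡ S U₃ →
    (S U₂ ≡ S U₁) × (S U₁ ≡ S U₃)
mainTheorem11 n S composable U₁ U₂ U₃ U₁⊆U₂ U₂⊆U₃ SU₁≡SU₃ =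
  trans (sandwiched-constant composable U₁⊆U₂ U₂⊆U₃ SU₁≡SU₃) (sym SU₁≡SU₃) , SU₁≡SU₃
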